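{- For all non-negative integers $m$ and $n$, $$ \sum_{i,j}\left\vert j^2-i^2\right\vert \binom {2n}{n+i}\binom {2m}{m+j}\ge 2nm\binom {2n}n \binom {2m}m, $$ where the sum runs over all integers $i,j$, and equality holds if and only if $m=n$.
   Context: Binomial coefficients $\binom{N}{r}$ with $N\ge 0$ are zero unless $0\le r\le N$, so the sum is finite. -}

module Defs where

open import Data.Nat using (ℕ; zero; suc; _+_; _*_; ∣_-_∣)
open import Data.Nat.Combinatorics using (_C_)

sumUpTo : ℕ → (ℕ → ℕ) → ℕ
sumUpTo zero    f = f 0
sumUpTo (suc n) f = sumUpTo n f + f (suc n)

-- The term for indices i = k - n, j = l - m (as integers), written via
-- k = n + i ∈ [0, 2n], l = m + j ∈ [0, 2m]; |i| = ∣ k - n ∣, |j| = ∣ l - m ∣.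
-- |j² - i²| = ∣ |j|² - |i|² ∣.
term : ℕ → ℕ → ℕ → ℕ → ℕ
term n m k l =
  ∣ ∣ l - m ∣ * ∣ l - m ∣ - ∣ k - n ∣ * ∣ k - n ∣ ∣ * ((2 * n) C k) * ((2 * m) C l)

-- Σ_{i,j ∈ ℤ} |j² - i²| C(2n, n+i) C(2m, m+j); all other terms vanish.
LHS : ℕ → ℕ → ℕ
LHS n m = sumUpTo (2 * n) λ k → sumUpTo (2 * m) λ l → term n m k l

RHS : ℕ → ℕ → ℕ
RHS n m = 2 * n * m * ((2 * n) C n) * ((2 * m) C m)

-- Writing |q² − p²| = Σ_t (2t+1)·[t lies between p and q] turns the double sum into
-- L(n,m) = Σ_t (2t+1)(O_n(t) I_m(t) + I_n(t) O_m(t)), where O_n(t) (outer) and I_n(t) = 4^n − O_n(t)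
-- (inner) are the total weights of C(2n, n+i) over |i| > t and over |i| ≤ t.  Expanding
-- 4^m 4^n = (O_m + I_m)(O_n + I_n) gives, with x = O_n I_m and y = I_n O_m,
--   4^m 4^n L(n,m) + Σ_t (2t+1)·2xy = Σ_t (2t+1)(x² + y²) + (4^m c_n)² + (4^n c_m)²,
-- where c_n = n C(2n,n) (central) and c_n² = Σ_t (2t+1) O_n(t) I_n(t) is the diagonal case
-- L(n,n) = 2 c_n².  Two uses of 2ab ≤ a² + b² give L(n,m) ≥ 2 c_n c_m = R(n,m), with equality
-- only if 4^m c_n = 4^n c_m, which forces m = n because c_{n+1} > 4 c_n.
-- The diagonal case is summed along the antidiagonals k + l = s: every inner sum, and then
-- the sum over s, is the total variation of a unimodal sequence, hence twice its peak.

module Submission where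

open import Defs
open import Data.Nat using (ℕ; _≤_)
open import Data.Product using (_×_)
open import Function.Bundles using (_⇔_)
open import Relation.Binary.PropositionalEquality using (_≡_)

open import Data.Bool using (Bool; true; false; not)
open import Data.Empty using (⊥-elim)
open import Data.Integer as ℤ using (ℤ)
import Data.Integer.Properties as ℤ
import Data.Integer.Tactic.RingSolver as ℤ-Solver
open import Data.Nat
open import Data.Nat.Combinatorics using (_C_; nCk+nC[k+1]≡[n+1]C[k+1]; k>n⇒nCk≡0; nC1≡n)
open import Data.Nat.Properties
open import Data.Nat.Tactic.RingSolver using (solve-∀)
open import Data.Product using (_,_)
open import Data.Sum using (inj₁; inj₂; reduce)
open import Function using (_∘_)
open import Function.Bundles using (mk⇔)
open import Relation.Binary.Definitions using (tri<; tri≈; tri>)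
open import Relation.Binary.PropositionalEquality
open import Relation.Nullary using (yes; no)

-- Finite sums

m+n≡o⇒∣m-o∣≡n : ∀ m n {o} → m + n ≡ o → ∣ m - o ∣ ≡ n
m+n≡o⇒∣m-o∣≡n m n refl = ∣m-m+n∣≡n m n

m+n≡o⇒∣o-m∣≡n : ∀ m n {o} → m + n ≡ o → ∣ o - m ∣ ≡ n
m+n≡o⇒∣o-m∣≡n m n refl = trans (∣-∣-comm (m + n) m) (∣m-m+n∣≡n m n)

m+n≡o⇒o∸m≡n : ∀ m n {o} → m + n ≡ o → o ∸ m ≡ n
m+n≡o⇒o∸m≡n m n refl = m+n∸m≡n m n

sumUpTo-cong : ∀ n {f g : ℕ → ℕ} → (∀ k → k ≤ n → f k ≡ g k) → sumUpTo n f ≡ sumUpTo n g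
sumUpTo-cong zero    f≗g = f≗g 0 z≤n
sumUpTo-cong (suc n) f≗g =
  cong₂ _+_ (sumUpTo-cong n λ k k≤n → f≗g k (m≤n⇒m≤1+n k≤n)) (f≗g (suc n) ≤-refl)

sumUpTo-mono : ∀ n {f g : ℕ → ℕ} → (∀ k → k ≤ n → f k ≤ g k) → sumUpTo n f ≤ sumUpTo n g
sumUpTo-mono zero    f≤g = f≤g 0 z≤n
sumUpTo-mono (suc n) f≤g =
  +-mono-≤ (sumUpTo-mono n λ k k≤n → f≤g k (m≤n⇒m≤1+n k≤n)) (f≤g (suc n) ≤-refl)

sumUpTo-zero : ∀ n {f : ℕ → ℕ} → (∀ k → k ≤ n → f k ≡ 0) → sumUpTo n f ≡ 0
sumUpTo-zero n f≗0 = trans (sumUpTo-cong n f≗0) (sumUpTo-const0 n)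
  where
  sumUpTo-const0 : ∀ n → sumUpTo n (λ _ → 0) ≡ 0
  sumUpTo-const0 zero    = refl
  sumUpTo-const0 (suc n) = cong (_+ 0) (sumUpTo-const0 n)

sumUpTo-+ : ∀ n (f g : ℕ → ℕ) → sumUpTo n (λ k → f k + g k) ≡ sumUpTo n f + sumUpTo n g
sumUpTo-+ zero    f g = refl
sumUpTo-+ (suc n) f g rewrite sumUpTo-+ n f g =
  +-assoc-comm (sumUpTo n f) (sumUpTo n g) (f (suc n)) (g (suc n))
  where
  +-assoc-comm : ∀ a b c d → a + b + (c + d) ≡ a + c + (b + d)
  +-assoc-comm = solve-∀

sumUpTo-*ˡ : ∀ n c (f : ℕ → ℕ) → sumUpTo n (λ k → c * f k) ≡ c * sumUpTo n f
sumUpTo-*ˡ zero    c f = refl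
sumUpTo-*ˡ (suc n) c f rewrite sumUpTo-*ˡ n c f = sym (*-distribˡ-+ c (sumUpTo n f) (f (suc n)))

sumUpTo-*ʳ : ∀ n c (f : ℕ → ℕ) → sumUpTo n (λ k → f k * c) ≡ sumUpTo n f * c
sumUpTo-*ʳ zero    c f = refl
sumUpTo-*ʳ (suc n) c f rewrite sumUpTo-*ʳ n c f = sym (*-distribʳ-+ c (sumUpTo n f) (f (suc n)))

sumUpTo-swap : ∀ m n (f : ℕ → ℕ → ℕ) →
  sumUpTo m (λ i → sumUpTo n (f i)) ≡ sumUpTo n (λ j → sumUpTo m (λ i → f i j))
sumUpTo-swap zero    n f = refl
sumUpTo-swap (suc m) n f rewrite sumUpTo-swap m n f =
  sym (sumUpTo-+ n (λ j → sumUpTo m (λ i → f i j)) (f (suc m)))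

sumUpTo-suc : ∀ n (f : ℕ → ℕ) → sumUpTo (suc n) f ≡ f 0 + sumUpTo n (f ∘ suc)
sumUpTo-suc zero    f = refl
sumUpTo-suc (suc n) f rewrite sumUpTo-suc n f = +-assoc (f 0) _ _

sumUpTo-split : ∀ m n (f : ℕ → ℕ) →
  sumUpTo (m + suc n) f ≡ sumUpTo m f + sumUpTo n (λ k → f (suc m + k))
sumUpTo-split m zero    f rewrite +-identityʳ m | +-comm m 1 = refl
sumUpTo-split m (suc n) f rewrite +-suc m (suc n) | sumUpTo-split m n f | +-suc m n =
  +-assoc (sumUpTo m f) _ _

sumUpTo-extend : ∀ m n {f : ℕ → ℕ} → m ≤ n → (∀ k → m < k → f k ≡ 0) → sumUpTo n f ≡ sumUpTo m f
sumUpTo-extend m n {f} m≤n f≗0 with m≤n⇒∃[o]m+o≡n m≤n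
... | d , refl = extend d
  where
  extend : ∀ d → sumUpTo (m + d) f ≡ sumUpTo m f
  extend zero    rewrite +-identityʳ m = refl
  extend (suc d) rewrite +-suc m d | extend d | f≗0 (suc (m + d)) (s≤s (m≤m+n m d)) = +-identityʳ _

sumUpTo-pairs : ∀ n (f : ℕ → ℕ) →
  sumUpTo (suc (n + n)) f ≡ sumUpTo n (λ p → f (p + p) + f (suc (p + p)))
sumUpTo-pairs zero    f = refl
sumUpTo-pairs (suc n) f rewrite +-suc n n | sumUpTo-pairs n f =
  +-assoc (sumUpTo n (λ p → f (p + p) + f (suc (p + p)))) _ _

sumUpTo-telescope-up : ∀ n (d u : ℕ → ℕ) → (∀ k → k ≤ n → d k + u k ≡ u (suc k)) →
  sumUpTo n d + u 0 ≡ u (suc n)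
sumUpTo-telescope-up zero    d u step = step 0 z≤n
sumUpTo-telescope-up (suc n) d u step = begin
  sumUpTo n d + d (suc n) + u 0    ≡⟨ +-assoc-comm (sumUpTo n d) _ _ ⟩
  d (suc n) + (sumUpTo n d + u 0)  ≡⟨ cong (d (suc n) +_) (sumUpTo-telescope-up n d u λ k k≤n → step k (m≤n⇒m≤1+n k≤n)) ⟩
  d (suc n) + u (suc n)            ≡⟨ step (suc n) ≤-refl ⟩
  u (suc (suc n))                  ∎
  where
  open ≡-Reasoning
  +-assoc-comm : ∀ a b c → a + b + c ≡ b + (a + c)
  +-assoc-comm = solve-∀

sumUpTo-telescope-down : ∀ n (d u : ℕ → ℕ) → (∀ k → k ≤ n → d k + u (suc k) ≡ u k) →
  sumUpTo n d + u (suc n) ≡ u 0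
sumUpTo-telescope-down zero    d u step = step 0 z≤n
sumUpTo-telescope-down (suc n) d u step = begin
  sumUpTo n d + d (suc n) + u (suc (suc n))    ≡⟨ +-assoc (sumUpTo n d) _ _ ⟩
  sumUpTo n d + (d (suc n) + u (suc (suc n)))  ≡⟨ cong (sumUpTo n d +_) (step (suc n) ≤-refl) ⟩
  sumUpTo n d + u (suc n)                      ≡⟨ sumUpTo-telescope-down n d u (λ k k≤n → step k (m≤n⇒m≤1+n k≤n)) ⟩
  u 0                                          ∎
  where open ≡-Reasoning

sumUpTo-unimodal : ∀ p q (d u : ℕ → ℕ) → u 0 ≡ 0 → u (suc p + suc q) ≡ 0 →
  (∀ k → k ≤ p → d k + u k ≡ u (suc k)) →
  (∀ k → k ≤ q → d (suc p + k) + u (suc (suc p + k)) ≡ u (suc p + k)) →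
  sumUpTo (p + suc q) d ≡ 2 * u (suc p)
sumUpTo-unimodal p q d u u[0]≡0 u[end]≡0 up down = begin
  sumUpTo (p + suc q) d
    ≡⟨ sumUpTo-split p q d ⟩
  sumUpTo p d + sumUpTo q (λ k → d (suc p + k))
    ≡⟨ cong₂ _+_ (add-zero (sumUpTo p d) u[0]≡0) (add-zero (sumUpTo q (λ k → d (suc p + k))) u[end]≡0) ⟩
  (sumUpTo p d + u 0) + (sumUpTo q (λ k → d (suc p + k)) + u (suc p + suc q))
    ≡⟨ cong₂ _+_ (sumUpTo-telescope-up p d u up) (sumUpTo-telescope-down q _ (λ k → u (suc p + k)) down′) ⟩
  u (suc p) + u (suc p + 0)
    ≡⟨ cong (λ i → u (suc p) + u i) (+-identityʳ (suc p)) ⟩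
  u (suc p) + u (suc p)
    ≡⟨ cong (u (suc p) +_) (+-identityʳ _) ⟨
  2 * u (suc p)
    ∎
  where
  open ≡-Reasoning
  add-zero : ∀ a {b} → b ≡ 0 → a ≡ a + b
  add-zero a refl = sym (+-identityʳ a)
  down′ : ∀ k → k ≤ q → d (suc p + k) + u (suc p + suc k) ≡ u (suc p + k)
  down′ k k≤q rewrite +-suc (suc p) k = down k k≤q

sumUpTo-triangle : ∀ n (f : ℕ → ℕ → ℕ) →
  sumUpTo n (λ s → sumUpTo s (λ k → f k (s ∸ k))) ≡ sumUpTo n (λ k → sumUpTo (n ∸ k) (f k))
sumUpTo-triangle zero    f = refl
sumUpTo-triangle (suc n) f = begin
  sumUpTo n (λ s → sumUpTo s (λ k → f k (s ∸ k))) + (sumUpTo n (λ k → f k (suc n ∸ k)) + f (suc n) (n ∸ n))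
    ≡⟨ cong₂ (λ a b → a + (sumUpTo n (λ k → f k (suc n ∸ k)) + f (suc n) b)) (sumUpTo-triangle n f) (n∸n≡0 n) ⟩
  sumUpTo n (λ k → sumUpTo (n ∸ k) (f k)) + (sumUpTo n (λ k → f k (suc n ∸ k)) + f (suc n) 0)
    ≡⟨ sym (+-assoc (sumUpTo n (λ k → sumUpTo (n ∸ k) (f k))) _ _) ⟩
  sumUpTo n (λ k → sumUpTo (n ∸ k) (f k)) + sumUpTo n (λ k → f k (suc n ∸ k)) + f (suc n) 0
    ≡⟨ cong (_+ f (suc n) 0) (sym (sumUpTo-+ n _ _)) ⟩
  sumUpTo n (λ k → sumUpTo (n ∸ k) (f k) + f k (suc n ∸ k)) + f (suc n) 0
    ≡⟨ cong (_+ f (suc n) 0) (sumUpTo-cong n λ k k≤n → row k k≤n) ⟩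
  sumUpTo n (λ k → sumUpTo (suc n ∸ k) (f k)) + f (suc n) 0
    ≡⟨ cong (λ i → sumUpTo n (λ k → sumUpTo (suc n ∸ k) (f k)) + sumUpTo i (f (suc n))) (sym (n∸n≡0 n)) ⟩
  sumUpTo (suc n) (λ k → sumUpTo (suc n ∸ k) (f k))
    ∎
  where
  open ≡-Reasoning
  row : ∀ k → k ≤ n → sumUpTo (n ∸ k) (f k) + f k (suc n ∸ k) ≡ sumUpTo (suc n ∸ k) (f k)
  row k k≤n rewrite +-∸-assoc 1 k≤n = refl

sumUpTo-antidiagonals : ∀ n (f : ℕ → ℕ → ℕ) →
  (∀ k l → n < k → f k l ≡ 0) → (∀ k l → n < l → f k l ≡ 0) →
  sumUpTo n (λ k → sumUpTo n (f k)) ≡ sumUpTo (n + n) (λ s → sumUpTo s (λ k → f k (s ∸ k)))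
sumUpTo-antidiagonals n f f≗0ˡ f≗0ʳ = sym (begin
  sumUpTo (n + n) (λ s → sumUpTo s (λ k → f k (s ∸ k)))
    ≡⟨ sumUpTo-triangle (n + n) f ⟩
  sumUpTo (n + n) (λ k → sumUpTo (n + n ∸ k) (f k))
    ≡⟨ sumUpTo-extend n (n + n) (m≤m+n n n) (λ k n<k → sumUpTo-zero (n + n ∸ k) λ l _ → f≗0ˡ k l n<k) ⟩
  sumUpTo n (λ k → sumUpTo (n + n ∸ k) (f k))
    ≡⟨ sumUpTo-cong n (λ k k≤n → sumUpTo-extend n (n + n ∸ k) (m+n≤o⇒m≤o∸n n (+-monoʳ-≤ n k≤n)) (f≗0ʳ k)) ⟩
  sumUpTo n (λ k → sumUpTo n (f k))
    ∎)
  where open ≡-Reasoning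

-- Binomial coefficients

[k+1]*[n+1]C[k+1]≡[n+1]*nCk : ∀ n k → suc k * (suc n C suc k) ≡ suc n * (n C k)
[k+1]*[n+1]C[k+1]≡[n+1]*nCk zero    zero    = refl
[k+1]*[n+1]C[k+1]≡[n+1]*nCk zero    (suc k) rewrite k>n⇒nCk≡0 {1} {2 + k} (s≤s (s≤s z≤n)) = *-zeroʳ (2 + k)
[k+1]*[n+1]C[k+1]≡[n+1]*nCk (suc n) zero    rewrite nC1≡n (2 + n) =
  trans (+-identityʳ (2 + n)) (sym (*-identityʳ (2 + n)))
[k+1]*[n+1]C[k+1]≡[n+1]*nCk (suc n) (suc k) = begin
  (2 + k) * ((2 + n) C (2 + k))
    ≡⟨ cong ((2 + k) *_) (sym (nCk+nC[k+1]≡[n+1]C[k+1] (suc n) (suc k))) ⟩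
  (2 + k) * (suc n C suc k + suc n C (2 + k))
    ≡⟨ regroup (suc n C suc k) (suc n C (2 + k)) k ⟩
  suc n C suc k + (suc k * (suc n C suc k) + (2 + k) * (suc n C (2 + k)))
    ≡⟨ cong₂ (λ a b → suc n C suc k + (a + b))
         ([k+1]*[n+1]C[k+1]≡[n+1]*nCk n k) ([k+1]*[n+1]C[k+1]≡[n+1]*nCk n (suc k)) ⟩
  suc n C suc k + (suc n * (n C k) + suc n * (n C suc k))
    ≡⟨ cong (suc n C suc k +_) (sym (*-distribˡ-+ (suc n) (n C k) (n C suc k))) ⟩
  suc n C suc k + suc n * (n C k + n C suc k)
    ≡⟨ cong (λ x → suc n C suc k + suc n * x) (nCk+nC[k+1]≡[n+1]C[k+1] n k) ⟩
  (2 + n) * (suc n C suc k)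
    ∎
  where
  open ≡-Reasoning
  regroup : ∀ a b k → (2 + k) * (a + b) ≡ a + ((1 + k) * a + (2 + k) * b)
  regroup = solve-∀

0<nCk : ∀ {n k} → k ≤ n → 0 < n C k
0<nCk {n}     {zero}  _         = s≤s z≤n
0<nCk {suc n} {suc k} (s≤s k≤n) =
  subst (0 <_) (nCk+nC[k+1]≡[n+1]C[k+1] n k) (≤-trans (0<nCk k≤n) (m≤m+n (n C k) (n C suc k)))

sumUpTo-nC≡2^n : ∀ n → sumUpTo n (n C_) ≡ 2 ^ n
sumUpTo-nC≡2^n zero    = refl
sumUpTo-nC≡2^n (suc n) = begin
  sumUpTo (suc n) (suc n C_)
    ≡⟨ sumUpTo-suc n (suc n C_) ⟩
  1 + sumUpTo n (λ k → suc n C suc k)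
    ≡⟨ cong (1 +_) (sumUpTo-cong n λ k _ → sym (nCk+nC[k+1]≡[n+1]C[k+1] n k)) ⟩
  1 + sumUpTo n (λ k → n C k + n C suc k)
    ≡⟨ cong (1 +_) (sumUpTo-+ n (n C_) (λ k → n C suc k)) ⟩
  1 + (sumUpTo n (n C_) + sumUpTo n (λ k → n C suc k))
    ≡⟨ +-comm-middle 1 (sumUpTo n (n C_)) _ ⟩
  sumUpTo n (n C_) + (1 + sumUpTo n (λ k → n C suc k))
    ≡⟨ cong (sumUpTo n (n C_) +_) (sym (sumUpTo-suc n (n C_))) ⟩
  sumUpTo n (n C_) + (sumUpTo n (n C_) + n C suc n)
    ≡⟨ cong (λ x → sumUpTo n (n C_) + (sumUpTo n (n C_) + x)) (k>n⇒nCk≡0 (n<1+n n)) ⟩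
  2 * sumUpTo n (n C_)
    ≡⟨ cong (2 *_) (sumUpTo-nC≡2^n n) ⟩
  2 ^ suc n
    ∎
  where
  open ≡-Reasoning
  +-comm-middle : ∀ a b c → a + (b + c) ≡ b + (a + c)
  +-comm-middle = solve-∀

σ : ℕ → ℕ → ℕ
σ n k = k * (n C k)

σ-suc : ∀ n k → σ n (suc k) ≡ (n ∸ k) * (n C k)
σ-suc n k with k ≤? n
... | yes k≤n = +-cancelʳ-≡ (suc k * (n C k)) _ _ (begin
  suc k * (n C suc k) + suc k * (n C k)
    ≡⟨ sym (*-distribˡ-+ (suc k) (n C suc k) (n C k)) ⟩
  suc k * (n C suc k + n C k)
    ≡⟨ cong (suc k *_) (trans (+-comm (n C suc k) (n C k)) (nCk+nC[k+1]≡[n+1]C[k+1] n k)) ⟩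
  suc k * (suc n C suc k)
    ≡⟨ [k+1]*[n+1]C[k+1]≡[n+1]*nCk n k ⟩
  suc n * (n C k)
    ≡⟨ cong (_* (n C k)) (sym (trans (+-suc (n ∸ k) k) (cong suc (m∸n+n≡m k≤n)))) ⟩
  (n ∸ k + suc k) * (n C k)
    ≡⟨ *-distribʳ-+ (n C k) (n ∸ k) (suc k) ⟩
  (n ∸ k) * (n C k) + suc k * (n C k)
    ∎)
  where open ≡-Reasoning
... | no k≰n rewrite k>n⇒nCk≡0 (≰⇒> k≰n) | k>n⇒nCk≡0 (m<n⇒m<1+n (≰⇒> k≰n)) =
  trans (*-zeroʳ (suc k)) (sym (*-zeroʳ (n ∸ k)))

σ-middle : ∀ n → σ (n + n) (suc n) ≡ σ (n + n) n
σ-middle n = trans (σ-suc (n + n) n) (cong (_* ((n + n) C n)) (m+n∸m≡n n n))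

central : ℕ → ℕ
central n = σ (2 * n) n

central-suc : ∀ n → central (suc n) ≡ 2 * (suc (2 * n) * ((2 * n) C n))
central-suc n = begin
  central (suc n)
    ≡⟨ cong (λ m → σ m (suc n)) 2*[1+n]≡2+2*n ⟩
  suc n * (suc (suc (2 * n)) C suc n)
    ≡⟨ [k+1]*[n+1]C[k+1]≡[n+1]*nCk (suc (2 * n)) n ⟩
  suc (suc (2 * n)) * (suc (2 * n) C n)
    ≡⟨ cong (_* (suc (2 * n) C n)) 2*[1+n]≡2+2*n ⟨
  2 * suc n * (suc (2 * n) C n)
    ≡⟨ *-assoc 2 (suc n) _ ⟩
  2 * (suc n * (suc (2 * n) C n))
    ≡⟨ cong (2 *_) (trans (cong (_* (suc (2 * n) C n)) (sym 1+2n∸n≡1+n)) (sym (σ-suc (suc (2 * n)) n))) ⟩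
  2 * (suc n * (suc (2 * n) C suc n))
    ≡⟨ cong (2 *_) ([k+1]*[n+1]C[k+1]≡[n+1]*nCk (2 * n) n) ⟩
  2 * (suc (2 * n) * ((2 * n) C n))
    ∎
  where
  open ≡-Reasoning
  2*[1+n]≡2+2*n : 2 * suc n ≡ suc (suc (2 * n))
  2*[1+n]≡2+2*n = *-suc 2 n
  1+2n∸n≡1+n : suc (2 * n) ∸ n ≡ suc n
  1+2n∸n≡1+n rewrite +-identityʳ n = trans (+-∸-assoc 1 (m≤m+n n n)) (cong suc (m+n∸m≡n n n))

4*central<central-suc : ∀ n → 4 * central n < central (suc n)
4*central<central-suc n rewrite central-suc n = subst (4 * central n <_) (expand n ((2 * n) C n))
  (m<m+n (4 * central n) (≤-trans (0<nCk (m≤n*m n 2)) (m≤m+n _ _)))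
  where
  expand : ∀ n c → 4 * (n * c) + (c + c) ≡ 2 * ((1 + 2 * n) * c)
  expand = solve-∀

-- Layer decomposition

χ : Bool → ℕ
χ true  = 1
χ false = 0

<⇒<ᵇ≡true : ∀ {m n} → m < n → (m <ᵇ n) ≡ true
<⇒<ᵇ≡true {zero}  (s≤s _)   = refl
<⇒<ᵇ≡true {suc m} (s≤s m<n) = <⇒<ᵇ≡true m<n

≥⇒<ᵇ≡false : ∀ {m n} → n ≤ m → (m <ᵇ n) ≡ false
≥⇒<ᵇ≡false z≤n       = refl
≥⇒<ᵇ≡false (s≤s n≤m) = ≥⇒<ᵇ≡false n≤m

sumUpTo-odd : ∀ n → sumUpTo n (λ t → suc (t + t)) ≡ suc n * suc n
sumUpTo-odd zero    = refl
sumUpTo-odd (suc n) rewrite sumUpTo-odd n = square-suc n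
  where
  square-suc : ∀ n → suc n * suc n + suc (suc n + suc n) ≡ suc (suc n) * suc (suc n)
  square-suc = solve-∀

sumUpTo-odd-below : ∀ K p → p ≤ suc K → sumUpTo K (λ t → suc (t + t) * χ (t <ᵇ p)) ≡ p * p
sumUpTo-odd-below K zero    _ = sumUpTo-zero K λ t _ → *-zeroʳ (suc (t + t))
sumUpTo-odd-below K (suc p) (s≤s p≤K) = begin
  sumUpTo K (λ t → suc (t + t) * χ (t <ᵇ suc p))
    ≡⟨ sumUpTo-extend p K p≤K (λ t p<t → trans (cong (λ b → suc (t + t) * χ b) (≥⇒<ᵇ≡false p<t)) (*-zeroʳ (suc (t + t)))) ⟩
  sumUpTo p (λ t → suc (t + t) * χ (t <ᵇ suc p))
    ≡⟨ sumUpTo-cong p (λ t t≤p → trans (cong (λ b → suc (t + t) * χ b) (<⇒<ᵇ≡true (s≤s t≤p))) (*-identityʳ (suc (t + t)))) ⟩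
  sumUpTo p (λ t → suc (t + t))
    ≡⟨ sumUpTo-odd p ⟩
  suc p * suc p
    ∎
  where open ≡-Reasoning

separates : ℕ → ℕ → ℕ → ℕ
separates t p q = χ (t <ᵇ p) * χ (not (t <ᵇ q)) + χ (t <ᵇ q) * χ (not (t <ᵇ p))

separates-comm : ∀ t p q → separates t p q ≡ separates t q p
separates-comm t p q = +-comm (χ (t <ᵇ p) * χ (not (t <ᵇ q))) _

χ[t<p]+separates≡χ[t<q] : ∀ {p q} t → p ≤ q → χ (t <ᵇ p) + separates t p q ≡ χ (t <ᵇ q)
χ[t<p]+separates≡χ[t<q] {p} {q} t p≤q with t <? p | t <? q
... | yes t<p | _       rewrite <⇒<ᵇ≡true t<p | <⇒<ᵇ≡true (<-≤-trans t<p p≤q) = refl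
... | no t≮p  | yes t<q rewrite ≥⇒<ᵇ≡false (≮⇒≥ t≮p) | <⇒<ᵇ≡true t<q = refl
... | no t≮p  | no t≮q  rewrite ≥⇒<ᵇ≡false (≮⇒≥ t≮p) | ≥⇒<ᵇ≡false (≮⇒≥ t≮q) = refl

sumUpTo-separates : ∀ K {p q} → p ≤ q → q ≤ suc K →
  p * p + sumUpTo K (λ t → suc (t + t) * separates t p q) ≡ q * q
sumUpTo-separates K {p} {q} p≤q q≤1+K = begin
  p * p + sumUpTo K (λ t → suc (t + t) * separates t p q)
    ≡⟨ cong (_+ sumUpTo K (λ t → suc (t + t) * separates t p q)) (sumUpTo-odd-below K p (≤-trans p≤q q≤1+K)) ⟨
  sumUpTo K (λ t → suc (t + t) * χ (t <ᵇ p)) + sumUpTo K (λ t → suc (t + t) * separates t p q)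
    ≡⟨ sumUpTo-+ K _ _ ⟨
  sumUpTo K (λ t → suc (t + t) * χ (t <ᵇ p) + suc (t + t) * separates t p q)
    ≡⟨ sumUpTo-cong K (λ t _ → trans (sym (*-distribˡ-+ (suc (t + t)) (χ (t <ᵇ p)) (separates t p q)))
                                      (cong (suc (t + t) *_) (χ[t<p]+separates≡χ[t<q] t p≤q))) ⟩
  sumUpTo K (λ t → suc (t + t) * χ (t <ᵇ q))
    ≡⟨ sumUpTo-odd-below K q q≤1+K ⟩
  q * q
    ∎
  where open ≡-Reasoning

∣q²-p²∣≡sumUpTo-separates : ∀ K p q → p ≤ suc K → q ≤ suc K →
  ∣ q * q - p * p ∣ ≡ sumUpTo K (λ t → suc (t + t) * separates t p q)
∣q²-p²∣≡sumUpTo-separates K p q p≤1+K q≤1+K with ≤-total p q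
... | inj₁ p≤q = m+n≡o⇒∣o-m∣≡n (p * p) _ (sumUpTo-separates K p≤q q≤1+K)
... | inj₂ q≤p = begin
  ∣ q * q - p * p ∣
    ≡⟨ m+n≡o⇒∣m-o∣≡n (q * q) _ (sumUpTo-separates K q≤p p≤1+K) ⟩
  sumUpTo K (λ t → suc (t + t) * separates t q p)
    ≡⟨ sumUpTo-cong K (λ t _ → cong (suc (t + t) *_) (separates-comm t q p)) ⟩
  sumUpTo K (λ t → suc (t + t) * separates t p q)
    ∎
  where open ≡-Reasoning

sumUpTo-product : ∀ a b (f g : ℕ → ℕ) → sumUpTo a (λ k → sumUpTo b (λ l → f k * g l)) ≡ sumUpTo a f * sumUpTo b g
sumUpTo-product a b f g = trans (sumUpTo-cong a λ k _ → sumUpTo-*ˡ b (f k) g) (sumUpTo-*ʳ a (sumUpTo b g) f)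

outer : ℕ → ℕ → ℕ
outer n t = sumUpTo (2 * n) (λ k → χ (t <ᵇ ∣ k - n ∣) * ((2 * n) C k))

inner : ℕ → ℕ → ℕ
inner n t = sumUpTo (2 * n) (λ k → χ (not (t <ᵇ ∣ k - n ∣)) * ((2 * n) C k))

∣k-n∣≤2n : ∀ {k n} → k ≤ 2 * n → ∣ k - n ∣ ≤ 2 * n
∣k-n∣≤2n {k} {n} k≤2n = ≤-trans (∣m-n∣≤m⊔n k n) (⊔-lub k≤2n (m≤m+n n (n + 0)))

LHS-layers : ∀ K n m → 2 * n ≤ K → 2 * m ≤ K →
  LHS n m ≡ sumUpTo K (λ t → suc (t + t) * (outer n t * inner m t + inner n t * outer m t))
LHS-layers K n m 2n≤K 2m≤K = begin
  LHS n m
    ≡⟨ sumUpTo-cong (2 * n) (λ k k≤2n → sumUpTo-cong (2 * m) λ l l≤2m → expand k l k≤2n l≤2m) ⟩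
  sumUpTo (2 * n) (λ k → sumUpTo (2 * m) λ l → sumUpTo K λ t → suc (t + t) * cell t k l)
    ≡⟨ sumUpTo-cong (2 * n) (λ k _ → sumUpTo-swap (2 * m) K _) ⟩
  sumUpTo (2 * n) (λ k → sumUpTo K λ t → sumUpTo (2 * m) λ l → suc (t + t) * cell t k l)
    ≡⟨ sumUpTo-swap (2 * n) K _ ⟩
  sumUpTo K (λ t → sumUpTo (2 * n) λ k → sumUpTo (2 * m) λ l → suc (t + t) * cell t k l)
    ≡⟨ sumUpTo-cong K (λ t _ → trans (sumUpTo-cong (2 * n) λ k _ → sumUpTo-*ˡ (2 * m) (suc (t + t)) (cell t k))
                                      (sumUpTo-*ˡ (2 * n) (suc (t + t)) _)) ⟩
  sumUpTo K (λ t → suc (t + t) * sumUpTo (2 * n) λ k → sumUpTo (2 * m) λ l → cell t k l)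
    ≡⟨ sumUpTo-cong K (λ t _ → cong (suc (t + t) *_) (cells t)) ⟩
  sumUpTo K (λ t → suc (t + t) * (outer n t * inner m t + inner n t * outer m t))
    ∎
  where
  open ≡-Reasoning
  cell : ℕ → ℕ → ℕ → ℕ
  cell t k l = separates t ∣ k - n ∣ ∣ l - m ∣ * (((2 * n) C k) * ((2 * m) C l))
  expand : ∀ k l → k ≤ 2 * n → l ≤ 2 * m → term n m k l ≡ sumUpTo K (λ t → suc (t + t) * cell t k l)
  expand k l k≤2n l≤2m = begin
    ∣ ∣ l - m ∣ * ∣ l - m ∣ - ∣ k - n ∣ * ∣ k - n ∣ ∣ * ((2 * n) C k) * ((2 * m) C l)
      ≡⟨ *-assoc ∣ ∣ l - m ∣ * ∣ l - m ∣ - ∣ k - n ∣ * ∣ k - n ∣ ∣ ((2 * n) C k) ((2 * m) C l) ⟩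
    ∣ ∣ l - m ∣ * ∣ l - m ∣ - ∣ k - n ∣ * ∣ k - n ∣ ∣ * (((2 * n) C k) * ((2 * m) C l))
      ≡⟨ cong (_* (((2 * n) C k) * ((2 * m) C l)))
              (∣q²-p²∣≡sumUpTo-separates K ∣ k - n ∣ ∣ l - m ∣ (bound (∣k-n∣≤2n k≤2n) 2n≤K) (bound (∣k-n∣≤2n l≤2m) 2m≤K)) ⟩
    sumUpTo K (λ t → suc (t + t) * separates t ∣ k - n ∣ ∣ l - m ∣) * (((2 * n) C k) * ((2 * m) C l))
      ≡⟨ sumUpTo-*ʳ K _ _ ⟨
    sumUpTo K (λ t → suc (t + t) * separates t ∣ k - n ∣ ∣ l - m ∣ * (((2 * n) C k) * ((2 * m) C l)))
      ≡⟨ sumUpTo-cong K (λ t _ → *-assoc (suc (t + t)) (separates t ∣ k - n ∣ ∣ l - m ∣) _) ⟩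
    sumUpTo K (λ t → suc (t + t) * cell t k l)
      ∎
    where
    bound : ∀ {x y} → x ≤ y → y ≤ K → x ≤ suc K
    bound x≤y y≤K = m≤n⇒m≤1+n (≤-trans x≤y y≤K)
  cells : ∀ t → sumUpTo (2 * n) (λ k → sumUpTo (2 * m) λ l → cell t k l) ≡ outer n t * inner m t + inner n t * outer m t
  cells t = begin
    sumUpTo (2 * n) (λ k → sumUpTo (2 * m) λ l → cell t k l)
      ≡⟨ sumUpTo-cong (2 * n) (λ k _ → sumUpTo-cong (2 * m) λ l _ →
           split (χ (t <ᵇ ∣ k - n ∣)) (χ (not (t <ᵇ ∣ k - n ∣))) (χ (t <ᵇ ∣ l - m ∣)) (χ (not (t <ᵇ ∣ l - m ∣)))
                 ((2 * n) C k) ((2 * m) C l)) ⟩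
    sumUpTo (2 * n) (λ k → sumUpTo (2 * m) λ l → outerₙ k * innerₘ l + innerₙ k * outerₘ l)
      ≡⟨ sumUpTo-cong (2 * n) (λ k _ → sumUpTo-+ (2 * m) _ _) ⟩
    sumUpTo (2 * n) (λ k → sumUpTo (2 * m) (λ l → outerₙ k * innerₘ l) + sumUpTo (2 * m) (λ l → innerₙ k * outerₘ l))
      ≡⟨ sumUpTo-+ (2 * n) _ _ ⟩
    sumUpTo (2 * n) (λ k → sumUpTo (2 * m) (λ l → outerₙ k * innerₘ l))
      + sumUpTo (2 * n) (λ k → sumUpTo (2 * m) (λ l → innerₙ k * outerₘ l))
      ≡⟨ cong₂ _+_ (sumUpTo-product (2 * n) (2 * m) outerₙ innerₘ) (sumUpTo-product (2 * n) (2 * m) innerₙ outerₘ) ⟩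
    outer n t * inner m t + inner n t * outer m t
      ∎
    where
    outerₙ innerₙ outerₘ innerₘ : ℕ → ℕ
    outerₙ k = χ (t <ᵇ ∣ k - n ∣) * ((2 * n) C k)
    innerₙ k = χ (not (t <ᵇ ∣ k - n ∣)) * ((2 * n) C k)
    outerₘ l = χ (t <ᵇ ∣ l - m ∣) * ((2 * m) C l)
    innerₘ l = χ (not (t <ᵇ ∣ l - m ∣)) * ((2 * m) C l)
    split : ∀ a a′ b b′ c d → (a * b′ + b * a′) * (c * d) ≡ a * c * (b′ * d) + a′ * c * (b * d)
    split = solve-∀

outer+inner≡4^n : ∀ n t → outer n t + inner n t ≡ 4 ^ n
outer+inner≡4^n n t = begin
  outer n t + inner n t
    ≡⟨ sumUpTo-+ (2 * n) _ _ ⟨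
  sumUpTo (2 * n) (λ k → χ (t <ᵇ ∣ k - n ∣) * ((2 * n) C k) + χ (not (t <ᵇ ∣ k - n ∣)) * ((2 * n) C k))
    ≡⟨ sumUpTo-cong (2 * n) (λ k _ → χ-partition (t <ᵇ ∣ k - n ∣) ((2 * n) C k)) ⟩
  sumUpTo (2 * n) ((2 * n) C_)
    ≡⟨ sumUpTo-nC≡2^n (2 * n) ⟩
  2 ^ (2 * n)
    ≡⟨ ^-*-assoc 2 2 n ⟨
  4 ^ n
    ∎
  where
  open ≡-Reasoning
  χ-partition : ∀ b c → χ b * c + χ (not b) * c ≡ c
  χ-partition true  c = trans (+-identityʳ (c + 0)) (+-identityʳ c)
  χ-partition false c = +-identityʳ c

-- The diagonal case

∣m-n∣≡∣+m-+n∣ : ∀ m n → ∣ m - n ∣ ≡ ℤ.∣ ℤ.+ m ℤ.- ℤ.+ n ∣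
∣m-n∣≡∣+m-+n∣ m n rewrite ℤ.[+m]-[+n]≡m⊖n m n with ≤-total m n
... | inj₁ m≤n rewrite m≤n⇒∣m-n∣≡n∸m m≤n = sym (ℤ.∣⊖∣-≤ m≤n)
... | inj₂ n≤m rewrite m≤n⇒∣n-m∣≡n∸m n≤m | ℤ.∣m⊖n∣≡∣n⊖m∣ m n = sym (ℤ.∣⊖∣-≤ n≤m)

+∣i∣*∣i∣≡i*i : ∀ i → ℤ.+ (ℤ.∣ i ∣ * ℤ.∣ i ∣) ≡ i ℤ.* i
+∣i∣*∣i∣≡i*i (ℤ.+ m)      = ℤ.pos-* m m
+∣i∣*∣i∣≡i*i ℤ.-[1+ m ] = refl

∣[l-n]²-[k-n]²∣≡∣k+l-2n∣*∣l-k∣ : ∀ k l n →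
  ∣ ∣ l - n ∣ * ∣ l - n ∣ - ∣ k - n ∣ * ∣ k - n ∣ ∣ ≡ ∣ (k + l) - (n + n) ∣ * ∣ l - k ∣
∣[l-n]²-[k-n]²∣≡∣k+l-2n∣*∣l-k∣ k l n = begin
  ∣ ∣ l - n ∣ * ∣ l - n ∣ - ∣ k - n ∣ * ∣ k - n ∣ ∣
    ≡⟨ ∣m-n∣≡∣+m-+n∣ (∣ l - n ∣ * ∣ l - n ∣) (∣ k - n ∣ * ∣ k - n ∣) ⟩
  ℤ.∣ ℤ.+ (∣ l - n ∣ * ∣ l - n ∣) ℤ.- ℤ.+ (∣ k - n ∣ * ∣ k - n ∣) ∣
    ≡⟨ cong₂ (λ x y → ℤ.∣ ℤ.+ (x * x) ℤ.- ℤ.+ (y * y) ∣) (∣m-n∣≡∣+m-+n∣ l n) (∣m-n∣≡∣+m-+n∣ k n) ⟩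
  ℤ.∣ ℤ.+ (ℤ.∣ l′ ℤ.- n′ ∣ * ℤ.∣ l′ ℤ.- n′ ∣) ℤ.- ℤ.+ (ℤ.∣ k′ ℤ.- n′ ∣ * ℤ.∣ k′ ℤ.- n′ ∣) ∣
    ≡⟨ cong₂ (λ x y → ℤ.∣ x ℤ.- y ∣) (+∣i∣*∣i∣≡i*i (l′ ℤ.- n′)) (+∣i∣*∣i∣≡i*i (k′ ℤ.- n′)) ⟩
  ℤ.∣ (l′ ℤ.- n′) ℤ.* (l′ ℤ.- n′) ℤ.- (k′ ℤ.- n′) ℤ.* (k′ ℤ.- n′) ∣
    ≡⟨ cong ℤ.∣_∣ (difference-of-squares k′ l′ n′) ⟩
  ℤ.∣ ((k′ ℤ.+ l′) ℤ.- (n′ ℤ.+ n′)) ℤ.* (l′ ℤ.- k′) ∣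
    ≡⟨ ℤ.abs-* ((k′ ℤ.+ l′) ℤ.- (n′ ℤ.+ n′)) (l′ ℤ.- k′) ⟩
  ℤ.∣ (k′ ℤ.+ l′) ℤ.- (n′ ℤ.+ n′) ∣ * ℤ.∣ l′ ℤ.- k′ ∣
    ≡⟨ cong₂ (λ x y → ℤ.∣ x ℤ.- y ∣ * ℤ.∣ l′ ℤ.- k′ ∣) (ℤ.pos-+ k l) (ℤ.pos-+ n n) ⟨
  ℤ.∣ ℤ.+ (k + l) ℤ.- ℤ.+ (n + n) ∣ * ℤ.∣ l′ ℤ.- k′ ∣
    ≡⟨ cong₂ _*_ (∣m-n∣≡∣+m-+n∣ (k + l) (n + n)) (∣m-n∣≡∣+m-+n∣ l k) ⟨
  ∣ (k + l) - (n + n) ∣ * ∣ l - k ∣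
    ∎
  where
  open ≡-Reasoning
  k′ l′ n′ : ℤ
  k′ = ℤ.+ k
  l′ = ℤ.+ l
  n′ = ℤ.+ n
  difference-of-squares : ∀ k l n →
    (l ℤ.- n) ℤ.* (l ℤ.- n) ℤ.- (k ℤ.- n) ℤ.* (k ℤ.- n) ≡ ((k ℤ.+ l) ℤ.- (n ℤ.+ n)) ℤ.* (l ℤ.- k)
  difference-of-squares = ℤ-Solver.solve-∀

σ-step-identity : ∀ {M x y} → x ≤ y → y ≤ M → ∀ a b →
  M * ((y ∸ x) * (a * b)) + x * a * ((M ∸ y) * b) ≡ (M ∸ x) * a * (y * b)
σ-step-identity {x = x} x≤y y≤M a b with m≤n⇒∃[o]m+o≡n x≤y | m≤n⇒∃[o]m+o≡n y≤M
... | d , refl | e , refl rewrite m+n∸m≡n x d | m+n∸m≡n (x + d) e | +-assoc x d e | m+n∸m≡n x (d + e) =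
  identity x d e a b
  where
  identity : ∀ x d e a b → (x + (d + e)) * (d * (a * b)) + x * a * (e * b) ≡ (d + e) * a * ((x + d) * b)
  identity = solve-∀

-- By σ-suc this is the identity (M − x)·y − x·(M − y) = M·(y − x), times C(M,x)·C(M,y).
σ-step : ∀ M x y → x ≤ y →
  M * (∣ y - x ∣ * ((M C x) * (M C y))) + σ M x * σ M (suc y) ≡ σ M (suc x) * σ M y
σ-step M x y x≤y with y ≤? M
... | no y≰M rewrite k>n⇒nCk≡0 (≰⇒> y≰M) | k>n⇒nCk≡0 (m<n⇒m<1+n (≰⇒> y≰M)) =
  vanish M ∣ y - x ∣ (M C x) (σ M x) (σ M (suc x)) y
  where
  vanish : ∀ a b c d e f → a * (b * (c * 0)) + d * (suc f * 0) ≡ e * (f * 0)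
  vanish = solve-∀
... | yes y≤M = begin
  M * (∣ y - x ∣ * ((M C x) * (M C y))) + σ M x * σ M (suc y)
    ≡⟨ cong₂ (λ a b → M * (a * ((M C x) * (M C y))) + σ M x * b) (m≤n⇒∣n-m∣≡n∸m x≤y) (σ-suc M y) ⟩
  M * ((y ∸ x) * ((M C x) * (M C y))) + x * (M C x) * ((M ∸ y) * (M C y))
    ≡⟨ σ-step-identity x≤y y≤M (M C x) (M C y) ⟩
  (M ∸ x) * (M C x) * σ M y
    ≡⟨ cong (_* σ M y) (σ-suc M x) ⟨
  σ M (suc x) * σ M y
    ∎
  where open ≡-Reasoning

σ-step′ : ∀ M x y → y ≤ x →
  M * (∣ y - x ∣ * ((M C x) * (M C y))) + σ M (suc x) * σ M y ≡ σ M x * σ M (suc y)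
σ-step′ M x y y≤x = begin
  M * (∣ y - x ∣ * ((M C x) * (M C y))) + σ M (suc x) * σ M y
    ≡⟨ cong₂ (λ a b → M * (a * b) + σ M (suc x) * σ M y) (∣-∣-comm y x) (*-comm (M C x) (M C y)) ⟩
  M * (∣ x - y ∣ * ((M C y) * (M C x))) + σ M (suc x) * σ M y
    ≡⟨ cong (M * (∣ x - y ∣ * ((M C y) * (M C x))) +_) (*-comm (σ M (suc x)) (σ M y)) ⟩
  M * (∣ x - y ∣ * ((M C y) * (M C x))) + σ M y * σ M (suc x)
    ≡⟨ σ-step M y x y≤x ⟩
  σ M (suc y) * σ M x
    ≡⟨ *-comm (σ M (suc y)) (σ M x) ⟩
  σ M x * σ M (suc y)
    ∎
  where open ≡-Reasoning

antidiagonal : ℕ → ℕ → ℕ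
antidiagonal M s = sumUpTo s (λ k → ∣ (s ∸ k) - k ∣ * ((M C k) * (M C (s ∸ k))))

-- M·|s − 2k|·C(M,k)·C(M,s − k) is the increment between u k and u (k + 1), for the sequence
-- u k = σ M k · σ M (s + 1 − k), which rises up to the middle of the antidiagonal and falls after it.
antidiagonal-variation : ∀ M p q → p ≤ suc q → q ≤ suc p →
  M * antidiagonal M (p + suc q) ≡ 2 * (σ M (suc p) * σ M (suc q))
antidiagonal-variation M p q p≤1+q q≤1+p = begin
  M * antidiagonal M s
    ≡⟨ sumUpTo-*ˡ s M _ ⟨
  sumUpTo s d
    ≡⟨ sumUpTo-unimodal p q d u refl u[1+s]≡0 up down ⟩
  2 * (σ M (suc p) * σ M (suc s ∸ suc p))
    ≡⟨ cong (λ i → 2 * (σ M (suc p) * σ M i)) (m+n∸m≡n p (suc q)) ⟩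
  2 * (σ M (suc p) * σ M (suc q))
    ∎
  where
  open ≡-Reasoning
  s : ℕ
  s = p + suc q
  d : ℕ → ℕ
  d k = M * (∣ (s ∸ k) - k ∣ * ((M C k) * (M C (s ∸ k))))
  u : ℕ → ℕ
  u k = σ M k * σ M (suc s ∸ k)
  u[1+s]≡0 : u (suc s) ≡ 0
  u[1+s]≡0 rewrite n∸n≡0 s = *-zeroʳ (σ M (suc s))
  s∸[1+p]≡q : s ∸ suc p ≡ q
  s∸[1+p]≡q = trans (cong (_∸ suc p) (+-suc p q)) (m+n∸m≡n p q)
  up : ∀ k → k ≤ p → d k + u k ≡ u (suc k)
  up k k≤p rewrite +-∸-assoc 1 (≤-trans k≤p (m≤m+n p (suc q))) = σ-step M k (s ∸ k) k≤s∸k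
    where
    k≤s∸k : k ≤ s ∸ k
    k≤s∸k = ≤-trans k≤p (≤-trans p≤1+q (≤-trans (≤-reflexive (sym (m+n∸m≡n p (suc q)))) (∸-monoʳ-≤ s k≤p)))
  i≤s : ∀ k → k ≤ q → suc p + k ≤ s
  i≤s k k≤q = ≤-trans (+-monoʳ-≤ (suc p) k≤q) (≤-reflexive (sym (+-suc p q)))
  s∸i≤i : ∀ k → s ∸ (suc p + k) ≤ suc p + k
  s∸i≤i k = ≤-trans (∸-monoʳ-≤ s (m≤m+n (suc p) k)) (≤-trans (≤-reflexive s∸[1+p]≡q) (≤-trans q≤1+p (m≤m+n (suc p) k)))
  down : ∀ k → k ≤ q → d (suc p + k) + u (suc (suc p + k)) ≡ u (suc p + k)
  down k k≤q rewrite +-∸-assoc 1 (i≤s k k≤q) = σ-step′ M (suc p + k) (s ∸ (suc p + k)) (s∸i≤i k)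

diagonalSum : ℕ → ℕ
diagonalSum M = sumUpTo M (λ k → sumUpTo M (λ l → ∣ (k + l) - M ∣ * (∣ l - k ∣ * ((M C k) * (M C l)))))

diagonalSum-antidiagonals : ∀ M → diagonalSum M ≡ sumUpTo (M + M) (λ s → ∣ s - M ∣ * antidiagonal M s)
diagonalSum-antidiagonals M = begin
  diagonalSum M
    ≡⟨ sumUpTo-antidiagonals M f vanishˡ vanishʳ ⟩
  sumUpTo (M + M) (λ s → sumUpTo s (λ k → f k (s ∸ k)))
    ≡⟨ sumUpTo-cong (M + M) (λ s _ → antidiagonal-row s) ⟩
  sumUpTo (M + M) (λ s → ∣ s - M ∣ * antidiagonal M s)
    ∎
  where
  open ≡-Reasoning
  f : ℕ → ℕ → ℕ
  f k l = ∣ (k + l) - M ∣ * (∣ l - k ∣ * ((M C k) * (M C l)))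
  antidiagonal-row : ∀ s → sumUpTo s (λ k → f k (s ∸ k)) ≡ ∣ s - M ∣ * antidiagonal M s
  antidiagonal-row s = trans (sumUpTo-cong s λ k k≤s → cong (λ t → ∣ t - M ∣ * (∣ (s ∸ k) - k ∣ * ((M C k) * (M C (s ∸ k)))))
                                                             (m+[n∸m]≡n k≤s))
                             (sumUpTo-*ˡ s ∣ s - M ∣ _)
  vanishˡ : ∀ k l → M < k → f k l ≡ 0
  vanishˡ k l M<k rewrite k>n⇒nCk≡0 M<k | *-zeroʳ ∣ l - k ∣ = *-zeroʳ ∣ (k + l) - M ∣
  vanishʳ : ∀ k l → M < l → f k l ≡ 0
  vanishʳ k l M<l rewrite k>n⇒nCk≡0 M<l | *-zeroʳ (M C k) | *-zeroʳ ∣ l - k ∣ = *-zeroʳ ∣ (k + l) - M ∣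

diagonalTerm : ℕ → ℕ → ℕ
diagonalTerm M p = ∣ suc (p + p) - M ∣ * (σ M (suc p) * σ M (suc p))
                 + ∣ suc (suc (p + p)) - M ∣ * (σ M (suc p) * σ M (suc (suc p)))

diagonalSum-diagonalTerms : ∀ a → suc a * diagonalSum (suc a) ≡ 2 * sumUpTo a (diagonalTerm (suc a))
diagonalSum-diagonalTerms a = begin
  M * diagonalSum M
    ≡⟨ cong (M *_) (diagonalSum-antidiagonals M) ⟩
  M * sumUpTo (M + M) g
    ≡⟨ sumUpTo-*ˡ (M + M) M g ⟨
  sumUpTo (suc (a + suc a)) (λ s → M * g s)
    ≡⟨ cong (λ r → sumUpTo (suc r) (λ s → M * g s)) (+-suc a a) ⟩
  sumUpTo (suc (suc (a + a))) (λ s → M * g s)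
    ≡⟨ sumUpTo-suc (suc (a + a)) (λ s → M * g s) ⟩
  M * (M * 0) + sumUpTo (suc (a + a)) (λ s → M * g (suc s))
    ≡⟨ cong (_+ sumUpTo (suc (a + a)) (λ s → M * g (suc s))) (trans (cong (M *_) (*-zeroʳ M)) (*-zeroʳ M)) ⟩
  sumUpTo (suc (a + a)) (λ s → M * g (suc s))
    ≡⟨ sumUpTo-pairs a (λ s → M * g (suc s)) ⟩
  sumUpTo a (λ p → M * g (suc (p + p)) + M * g (suc (suc (p + p))))
    ≡⟨ sumUpTo-cong a (λ p _ → pair p) ⟩
  sumUpTo a (λ p → 2 * diagonalTerm M p)
    ≡⟨ sumUpTo-*ˡ a 2 (diagonalTerm M) ⟩
  2 * sumUpTo a (diagonalTerm M)
    ∎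
  where
  open ≡-Reasoning
  M : ℕ
  M = suc a
  g : ℕ → ℕ
  g s = ∣ s - M ∣ * antidiagonal M s
  odd : ∀ p → M * antidiagonal M (suc (p + p)) ≡ 2 * (σ M (suc p) * σ M (suc p))
  odd p = trans (cong (λ s → M * antidiagonal M s) (sym (+-suc p p))) (antidiagonal-variation M p p (n≤1+n p) (n≤1+n p))
  even : ∀ p → M * antidiagonal M (suc (suc (p + p))) ≡ 2 * (σ M (suc p) * σ M (suc (suc p)))
  even p = trans (cong (λ s → M * antidiagonal M s) (sym (trans (+-suc p (suc p)) (cong suc (+-suc p p)))))
                 (antidiagonal-variation M p (suc p) (m≤n⇒m≤1+n (n≤1+n p)) ≤-refl)
  pair : ∀ p → M * g (suc (p + p)) + M * g (suc (suc (p + p))) ≡ 2 * diagonalTerm M p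
  pair p = begin
    M * (w₁ * antidiagonal M (suc (p + p))) + M * (w₂ * antidiagonal M (suc (suc (p + p))))
      ≡⟨ cong₂ _+_ (x*[y*z]≡y*[x*z] M w₁ _) (x*[y*z]≡y*[x*z] M w₂ _) ⟩
    w₁ * (M * antidiagonal M (suc (p + p))) + w₂ * (M * antidiagonal M (suc (suc (p + p))))
      ≡⟨ cong₂ (λ x y → w₁ * x + w₂ * y) (odd p) (even p) ⟩
    w₁ * (2 * (σ M (suc p) * σ M (suc p))) + w₂ * (2 * (σ M (suc p) * σ M (suc (suc p))))
      ≡⟨ factor-2 w₁ w₂ _ _ ⟩
    2 * diagonalTerm M p
      ∎
    where
    w₁ w₂ : ℕ
    w₁ = ∣ suc (p + p) - M ∣
    w₂ = ∣ suc (suc (p + p)) - M ∣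
    x*[y*z]≡y*[x*z] : ∀ x y z → x * (y * z) ≡ y * (x * z)
    x*[y*z]≡y*[x*z] = solve-∀
    factor-2 : ∀ w₁ w₂ x y → w₁ * (2 * x) + w₂ * (2 * y) ≡ 2 * (w₁ * x + w₂ * y)
    factor-2 = solve-∀

diagonalTerm-ascent : ∀ k e → let M = suc (k + e) + suc (k + e) in
  diagonalTerm M k + k * (σ M (suc k) * σ M (suc k)) ≡ suc k * (σ M (suc (suc k)) * σ M (suc (suc k)))
diagonalTerm-ascent k e = begin
  ∣ suc (k + k) - M ∣ * (σ₁ * σ₁) + ∣ suc (suc (k + k)) - M ∣ * (σ₁ * σ₂) + k * (σ₁ * σ₁)
    ≡⟨ cong₂ (λ a b → a * (σ₁ * σ₁) + b * (σ₁ * σ₂) + k * (σ₁ * σ₁))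
             (m+n≡o⇒∣m-o∣≡n (suc (k + k)) (suc (e + e)) (odd-split k e))
             (m+n≡o⇒∣m-o∣≡n (suc (suc (k + k))) (e + e) (even-split k e)) ⟩
  suc (e + e) * (σ₁ * σ₁) + (e + e) * (σ₁ * σ₂) + k * (σ₁ * σ₁)
    ≡⟨ cong (λ x → suc (e + e) * (σ₁ * σ₁) + (e + e) * (σ₁ * x) + k * (σ₁ * σ₁)) σ₂≡ ⟩
  suc (e + e) * (σ₁ * σ₁) + (e + e) * (σ₁ * (suc (k + (e + e)) * c)) + k * (σ₁ * σ₁)
    ≡⟨ identity k e c ⟩
  suc k * (suc (k + (e + e)) * c * (suc (k + (e + e)) * c))
    ≡⟨ cong (λ x → suc k * (x * x)) σ₂≡ ⟨
  suc k * (σ₂ * σ₂)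
    ∎
  where
  open ≡-Reasoning
  M c σ₁ σ₂ : ℕ
  M = suc (k + e) + suc (k + e)
  c = M C suc k
  σ₁ = σ M (suc k)
  σ₂ = σ M (suc (suc k))
  odd-split : ∀ k e → suc (k + k) + suc (e + e) ≡ suc (k + e) + suc (k + e)
  odd-split = solve-∀
  even-split : ∀ k e → suc (suc (k + k)) + (e + e) ≡ suc (k + e) + suc (k + e)
  even-split = solve-∀
  σ₂≡ : σ₂ ≡ suc (k + (e + e)) * c
  σ₂≡ = trans (σ-suc M (suc k)) (cong (_* c) (m+n≡o⇒o∸m≡n (suc k) (suc (k + (e + e))) (rest k e)))
    where
    rest : ∀ k e → suc k + suc (k + (e + e)) ≡ suc (k + e) + suc (k + e)
    rest = solve-∀
  identity : ∀ k e c →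
    suc (e + e) * (suc k * c * (suc k * c)) + (e + e) * (suc k * c * (suc (k + (e + e)) * c))
      + k * (suc k * c * (suc k * c))
    ≡ suc k * (suc (k + (e + e)) * c * (suc (k + (e + e)) * c))
  identity = solve-∀

diagonalTerm-descent : ∀ j e → let M = suc (j + e) + suc (j + e); i = suc (j + e) + j in
  diagonalTerm M i + suc i * (σ M (suc (suc i)) * σ M (suc (suc i))) ≡ i * (σ M (suc i) * σ M (suc i))
diagonalTerm-descent j e = begin
  ∣ suc (i + i) - M ∣ * (σ₁ * σ₁) + ∣ suc (suc (i + i)) - M ∣ * (σ₁ * σ₂) + suc i * (σ₂ * σ₂)
    ≡⟨ cong₂ (λ a b → a * (σ₁ * σ₁) + b * (σ₁ * σ₂) + suc i * (σ₂ * σ₂))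
             (m+n≡o⇒∣o-m∣≡n M (suc (j + j)) (odd-split j e))
             (m+n≡o⇒∣o-m∣≡n M (suc (suc (j + j))) (even-split j e)) ⟩
  suc (j + j) * (σ₁ * σ₁) + suc (suc (j + j)) * (σ₁ * σ₂) + suc i * (σ₂ * σ₂)
    ≡⟨ cong (λ x → suc (j + j) * (σ₁ * σ₁) + suc (suc (j + j)) * (σ₁ * x) + suc i * (x * x)) σ₂≡ ⟩
  suc (j + j) * (σ₁ * σ₁) + suc (suc (j + j)) * (σ₁ * (e * c)) + suc i * (e * c * (e * c))
    ≡⟨ identity j e c ⟩
  i * (σ₁ * σ₁)
    ∎
  where
  open ≡-Reasoning
  M i c σ₁ σ₂ : ℕ
  M = suc (j + e) + suc (j + e)
  i = suc (j + e) + j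
  c = M C suc i
  σ₁ = σ M (suc i)
  σ₂ = σ M (suc (suc i))
  odd-split : ∀ j e → suc (j + e) + suc (j + e) + suc (j + j) ≡ suc ((suc (j + e) + j) + (suc (j + e) + j))
  odd-split = solve-∀
  even-split : ∀ j e → suc (j + e) + suc (j + e) + suc (suc (j + j)) ≡ suc (suc ((suc (j + e) + j) + (suc (j + e) + j)))
  even-split = solve-∀
  rest : ∀ j e → suc (suc (j + e) + j) + e ≡ suc (j + e) + suc (j + e)
  rest = solve-∀
  σ₂≡ : σ₂ ≡ e * c
  σ₂≡ = trans (σ-suc M (suc i)) (cong (_* c) (m+n≡o⇒o∸m≡n (suc i) e (rest j e)))
  identity : ∀ j e c →
    suc (j + j) * ((2 + j + e + j) * c * ((2 + j + e + j) * c)) + suc (suc (j + j)) * ((2 + j + e + j) * c * (e * c))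
      + (2 + j + e + j) * (e * c * (e * c))
    ≡ (1 + j + e + j) * ((2 + j + e + j) * c * ((2 + j + e + j) * c))
  identity = solve-∀

-- Here the unimodal sequence is u p = p · σ M (p + 1)², with peak at p = M / 2.
diagonalTerm-variation : ∀ n → let M = suc n + suc n in
  sumUpTo (n + suc n) (diagonalTerm M) ≡ 2 * (suc n * (σ M (suc (suc n)) * σ M (suc (suc n))))
diagonalTerm-variation n = begin
  sumUpTo (n + suc n) (diagonalTerm M)
    ≡⟨ sumUpTo-unimodal n n (diagonalTerm M) u refl u[M]≡0 ascent descent ⟩
  2 * u (suc n)
    ∎
  where
  open ≡-Reasoning
  M : ℕ
  M = suc n + suc n
  u : ℕ → ℕ
  u k = k * (σ M (suc k) * σ M (suc k))
  u[M]≡0 : u M ≡ 0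
  u[M]≡0 rewrite k>n⇒nCk≡0 (n<1+n M) | *-zeroʳ (suc M) = *-zeroʳ M
  ascent : ∀ k → k ≤ n → diagonalTerm M k + u k ≡ u (suc k)
  ascent k k≤n with m≤n⇒∃[o]m+o≡n k≤n
  ... | e , refl = diagonalTerm-ascent k e
  descent : ∀ j → j ≤ n → diagonalTerm M (suc n + j) + u (suc (suc n + j)) ≡ u (suc n + j)
  descent j j≤n with m≤n⇒∃[o]m+o≡n j≤n
  ... | e , refl = diagonalTerm-descent j e

diagonalSum-closed : ∀ n → diagonalSum (n + n) ≡ 2 * (σ (n + n) n * σ (n + n) n)
diagonalSum-closed zero    = refl
diagonalSum-closed (suc n) = *-cancelˡ-≡ _ _ M (begin
  M * diagonalSum M
    ≡⟨ diagonalSum-diagonalTerms (n + suc n) ⟩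
  2 * sumUpTo (n + suc n) (diagonalTerm M)
    ≡⟨ cong (2 *_) (diagonalTerm-variation n) ⟩
  2 * (2 * (suc n * (σ M (suc (suc n)) * σ M (suc (suc n)))))
    ≡⟨ cong (λ x → 2 * (2 * (suc n * (x * x)))) (σ-middle (suc n)) ⟩
  2 * (2 * (suc n * (σ M (suc n) * σ M (suc n))))
    ≡⟨ regroup n (σ M (suc n)) ⟩
  M * (2 * (σ M (suc n) * σ M (suc n)))
    ∎)
  where
  open ≡-Reasoning
  M : ℕ
  M = suc n + suc n
  regroup : ∀ n x → 2 * (2 * (suc n * (x * x))) ≡ (suc n + suc n) * (2 * (x * x))
  regroup = solve-∀

RHS≡2*central*central : ∀ n m → RHS n m ≡ 2 * (central n * central m)
RHS≡2*central*central n m = regroup n m ((2 * n) C n) ((2 * m) C m)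
  where
  regroup : ∀ n m a b → 2 * n * m * a * b ≡ 2 * (n * a * (m * b))
  regroup = solve-∀

LHS-diagonal : ∀ n → LHS n n ≡ RHS n n
LHS-diagonal n = begin
  LHS n n
    ≡⟨ sumUpTo-cong (2 * n) (λ k _ → sumUpTo-cong (2 * n) λ l _ → factor k l) ⟩
  diagonalSum (2 * n)
    ≡⟨ cong diagonalSum 2*n≡n+n ⟩
  diagonalSum (n + n)
    ≡⟨ diagonalSum-closed n ⟩
  2 * (σ (n + n) n * σ (n + n) n)
    ≡⟨ cong (λ M → 2 * (σ M n * σ M n)) 2*n≡n+n ⟨
  2 * (central n * central n)
    ≡⟨ RHS≡2*central*central n n ⟨
  RHS n n
    ∎
  where
  open ≡-Reasoning
  2*n≡n+n : 2 * n ≡ n + n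
  2*n≡n+n = cong (n +_) (+-identityʳ n)
  factor : ∀ k l → term n n k l ≡ ∣ (k + l) - 2 * n ∣ * (∣ l - k ∣ * (((2 * n) C k) * ((2 * n) C l)))
  factor k l = begin
    ∣ ∣ l - n ∣ * ∣ l - n ∣ - ∣ k - n ∣ * ∣ k - n ∣ ∣ * ((2 * n) C k) * ((2 * n) C l)
      ≡⟨ cong (λ x → x * ((2 * n) C k) * ((2 * n) C l)) (∣[l-n]²-[k-n]²∣≡∣k+l-2n∣*∣l-k∣ k l n) ⟩
    ∣ (k + l) - (n + n) ∣ * ∣ l - k ∣ * ((2 * n) C k) * ((2 * n) C l)
      ≡⟨ cong (λ M → ∣ (k + l) - M ∣ * ∣ l - k ∣ * ((2 * n) C k) * ((2 * n) C l)) 2*n≡n+n ⟨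
    ∣ (k + l) - 2 * n ∣ * ∣ l - k ∣ * ((2 * n) C k) * ((2 * n) C l)
      ≡⟨ reassoc ∣ (k + l) - 2 * n ∣ ∣ l - k ∣ ((2 * n) C k) ((2 * n) C l) ⟩
    ∣ (k + l) - 2 * n ∣ * (∣ l - k ∣ * (((2 * n) C k) * ((2 * n) C l)))
      ∎
    where
    reassoc : ∀ a b c d → a * b * c * d ≡ a * (b * (c * d))
    reassoc = solve-∀

-- The inequality and its equality case

layers-diagonal : ∀ K n → 2 * n ≤ K →
  sumUpTo K (λ t → suc (t + t) * (outer n t * inner n t)) ≡ central n * central n
layers-diagonal K n 2n≤K = *-cancelˡ-≡ _ _ 2 (begin
  2 * sumUpTo K (λ t → suc (t + t) * (outer n t * inner n t))
    ≡⟨ sumUpTo-*ˡ K 2 _ ⟨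
  sumUpTo K (λ t → 2 * (suc (t + t) * (outer n t * inner n t)))
    ≡⟨ sumUpTo-cong K (λ t _ → double (suc (t + t)) (outer n t) (inner n t)) ⟩
  sumUpTo K (λ t → suc (t + t) * (outer n t * inner n t + inner n t * outer n t))
    ≡⟨ LHS-layers K n n 2n≤K 2n≤K ⟨
  LHS n n
    ≡⟨ LHS-diagonal n ⟩
  RHS n n
    ≡⟨ RHS≡2*central*central n n ⟩
  2 * (central n * central n)
    ∎)
  where
  open ≡-Reasoning
  double : ∀ w a b → 2 * (w * (a * b)) ≡ w * (a * b + b * a)
  double = solve-∀

∣m-n∣²+2mn≡m²+n² : ∀ m n → ∣ m - n ∣ * ∣ m - n ∣ + 2 * (m * n) ≡ m * m + n * n
∣m-n∣²+2mn≡m²+n² m n with ≤-total m n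
... | inj₁ m≤n with m≤n⇒∃[o]m+o≡n m≤n
...   | d , refl rewrite ∣m-m+n∣≡n m d = expand m d
  where
  expand : ∀ m d → d * d + 2 * (m * (m + d)) ≡ m * m + (m + d) * (m + d)
  expand = solve-∀
∣m-n∣²+2mn≡m²+n² m n | inj₂ n≤m with m≤n⇒∃[o]m+o≡n n≤m
...   | d , refl rewrite ∣-∣-comm (n + d) n | ∣m-m+n∣≡n n d = expand n d
  where
  expand : ∀ n d → d * d + 2 * ((n + d) * n) ≡ (n + d) * (n + d) + n * n
  expand = solve-∀

2mn≤m²+n² : ∀ m n → 2 * (m * n) ≤ m * m + n * n
2mn≤m²+n² m n = subst (2 * (m * n) ≤_) (∣m-n∣²+2mn≡m²+n² m n) (m≤n+m (2 * (m * n)) (∣ m - n ∣ * ∣ m - n ∣))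

2mn≡m²+n²⇒m≡n : ∀ m n → m * m + n * n ≡ 2 * (m * n) → m ≡ n
2mn≡m²+n²⇒m≡n m n eq = ∣m-n∣≡0⇒m≡n (reduce (m*n≡0⇒m≡0∨n≡0 ∣ m - n ∣ (+-cancelʳ-≡ (2 * (m * n)) (∣ m - n ∣ * ∣ m - n ∣) 0 (trans (∣m-n∣²+2mn≡m²+n² m n) eq))))

4^m*central[n]<4^n*central[m] : ∀ {n m} → n < m → 4 ^ m * central n < 4 ^ n * central m
4^m*central[n]<4^n*central[m] {n} {suc m} (s≤s n≤m) with m≤n⇒m<n∨m≡n n≤m
... | inj₂ refl = subst (_< 4 ^ n * central (suc n)) (x*[4*y]≡4*x*y (4 ^ n) (central n))
                        (*-monoʳ-< (4 ^ n) {{m^n≢0 4 n}} (4*central<central-suc n))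
  where
  x*[4*y]≡4*x*y : ∀ x y → x * (4 * y) ≡ 4 * x * y
  x*[4*y]≡4*x*y = solve-∀
... | inj₁ n<m = begin-strict
  4 ^ suc m * central n      ≡⟨ *-assoc 4 (4 ^ m) (central n) ⟩
  4 * (4 ^ m * central n)    <⟨ *-monoʳ-< 4 (4^m*central[n]<4^n*central[m] n<m) ⟩
  4 * (4 ^ n * central m)    ≡⟨ x*[y*z]≡y*[x*z] 4 (4 ^ n) (central m) ⟩
  4 ^ n * (4 * central m)    ≤⟨ *-monoʳ-≤ (4 ^ n) (<⇒≤ (4*central<central-suc m)) ⟩
  4 ^ n * central (suc m)    ∎
  where
  open ≤-Reasoning
  x*[y*z]≡y*[x*z] : ∀ x y z → x * (y * z) ≡ y * (x * z)
  x*[y*z]≡y*[x*z] = solve-∀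

4^m*central[n]≡4^n*central[m]⇒m≡n : ∀ n m → 4 ^ m * central n ≡ 4 ^ n * central m → m ≡ n
4^m*central[n]≡4^n*central[m]⇒m≡n n m eq with <-cmp n m
... | tri< n<m _ _ = ⊥-elim (<-irrefl eq (4^m*central[n]<4^n*central[m] n<m))
... | tri≈ _ refl _ = refl
... | tri> _ _ m<n = ⊥-elim (<-irrefl (sym eq) (4^m*central[n]<4^n*central[m] m<n))

m+n≡o+p⇒o≤m⇒p≤n⇒n≡p : ∀ {m n o p} → m + n ≡ o + p → o ≤ m → p ≤ n → n ≡ p
m+n≡o+p⇒o≤m⇒p≤n⇒n≡p {m} {n} {o} {p} eq o≤m p≤n =
  ≤-antisym (+-cancelˡ-≤ m n p (≤-trans (≤-reflexive eq) (+-monoˡ-≤ p o≤m))) p≤n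

module _ (n m : ℕ) where

  private
    layerBound : ℕ
    layerBound = 2 * n + 2 * m

    x y : ℕ → ℕ
    x t = outer n t * inner m t
    y t = inner n t * outer m t

    squares cross : ℕ
    squares = sumUpTo layerBound (λ t → suc (t + t) * (x t * x t + y t * y t))
    cross   = sumUpTo layerBound (λ t → suc (t + t) * (2 * (x t * y t)))

    a b : ℕ
    a = 4 ^ m * central n
    b = 4 ^ n * central m

  layer-balance : ∀ t → 4 ^ m * 4 ^ n * (suc (t + t) * (x t + y t)) + suc (t + t) * (2 * (x t * y t))
                      ≡ suc (t + t) * (x t * x t + y t * y t)
                        + 4 ^ m * 4 ^ m * (suc (t + t) * (outer n t * inner n t))
                        + 4 ^ n * 4 ^ n * (suc (t + t) * (outer m t * inner m t))
  layer-balance t =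
    subst₂ (λ N M → M * N * (w * (x t + y t)) + w * (2 * (x t * y t))
                    ≡ w * (x t * x t + y t * y t) + M * M * (w * (outer n t * inner n t)) + N * N * (w * (outer m t * inner m t)))
           (outer+inner≡4^n n t) (outer+inner≡4^n m t)
           (identity w (outer n t) (inner n t) (outer m t) (inner m t))
    where
    w : ℕ
    w = suc (t + t)
    identity : ∀ w o i o′ i′ →
      (o′ + i′) * (o + i) * (w * (o * i′ + i * o′)) + w * (2 * (o * i′ * (i * o′)))
      ≡ w * (o * i′ * (o * i′) + i * o′ * (i * o′)) + (o′ + i′) * (o′ + i′) * (w * (o * i)) + (o + i) * (o + i) * (w * (o′ * i′))
    identity = solve-∀

  LHS-balance : 4 ^ m * 4 ^ n * LHS n m + cross ≡ squares + (a * a + b * b)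
  LHS-balance = begin
    4 ^ m * 4 ^ n * LHS n m + cross
      ≡⟨ cong (λ L → 4 ^ m * 4 ^ n * L + cross) (LHS-layers layerBound n m 2n≤K 2m≤K) ⟩
    4 ^ m * 4 ^ n * sumUpTo layerBound (λ t → suc (t + t) * (x t + y t)) + cross
      ≡⟨ cong (_+ cross) (sumUpTo-*ˡ layerBound (4 ^ m * 4 ^ n) _) ⟨
    sumUpTo layerBound (λ t → 4 ^ m * 4 ^ n * (suc (t + t) * (x t + y t))) + cross
      ≡⟨ sumUpTo-+ layerBound _ _ ⟨
    sumUpTo layerBound (λ t → 4 ^ m * 4 ^ n * (suc (t + t) * (x t + y t)) + suc (t + t) * (2 * (x t * y t)))
      ≡⟨ sumUpTo-cong layerBound (λ t _ → layer-balance t) ⟩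
    sumUpTo layerBound (λ t → suc (t + t) * (x t * x t + y t * y t)
                               + 4 ^ m * 4 ^ m * (suc (t + t) * (outer n t * inner n t))
                               + 4 ^ n * 4 ^ n * (suc (t + t) * (outer m t * inner m t)))
      ≡⟨ sumUpTo-+ layerBound _ _ ⟩
    sumUpTo layerBound (λ t → suc (t + t) * (x t * x t + y t * y t)
                               + 4 ^ m * 4 ^ m * (suc (t + t) * (outer n t * inner n t)))
      + sumUpTo layerBound (λ t → 4 ^ n * 4 ^ n * (suc (t + t) * (outer m t * inner m t)))
      ≡⟨ cong₂ _+_ (trans (sumUpTo-+ layerBound _ _) (cong (squares +_) (sumUpTo-*ˡ layerBound (4 ^ m * 4 ^ m) _)))
                   (sumUpTo-*ˡ layerBound (4 ^ n * 4 ^ n) _) ⟩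
    squares + 4 ^ m * 4 ^ m * sumUpTo layerBound (λ t → suc (t + t) * (outer n t * inner n t))
            + 4 ^ n * 4 ^ n * sumUpTo layerBound (λ t → suc (t + t) * (outer m t * inner m t))
      ≡⟨ cong₂ (λ u v → squares + 4 ^ m * 4 ^ m * u + 4 ^ n * 4 ^ n * v)
               (layers-diagonal layerBound n 2n≤K) (layers-diagonal layerBound m 2m≤K) ⟩
    squares + 4 ^ m * 4 ^ m * (central n * central n) + 4 ^ n * 4 ^ n * (central m * central m)
      ≡⟨ regroup squares (4 ^ m) (4 ^ n) (central n) (central m) ⟩
    squares + (a * a + b * b)
      ∎
    where
    open ≡-Reasoning
    2n≤K : 2 * n ≤ layerBound
    2n≤K = m≤m+n (2 * n) (2 * m)
    2m≤K : 2 * m ≤ layerBound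
    2m≤K = m≤n+m (2 * m) (2 * n)
    regroup : ∀ s M N u v → s + M * M * (u * u) + N * N * (v * v) ≡ s + (M * u * (M * u) + N * v * (N * v))
    regroup = solve-∀

  cross≤squares : cross ≤ squares
  cross≤squares = sumUpTo-mono layerBound λ t _ → *-monoʳ-≤ (suc (t + t)) (2mn≤m²+n² (x t) (y t))

  2ab≡4^m*4^n*RHS : 2 * (a * b) ≡ 4 ^ m * 4 ^ n * RHS n m
  2ab≡4^m*4^n*RHS = trans (regroup (4 ^ m) (4 ^ n) (central n) (central m)) (cong (4 ^ m * 4 ^ n *_) (sym (RHS≡2*central*central n m)))
    where
    regroup : ∀ M N u v → 2 * (M * u * (N * v)) ≡ M * N * (2 * (u * v))
    regroup = solve-∀

  private instance
    4^m*4^n≢0 : NonZero (4 ^ m * 4 ^ n)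
    4^m*4^n≢0 = m*n≢0 (4 ^ m) (4 ^ n) {{m^n≢0 4 m}} {{m^n≢0 4 n}}

  RHS≤LHS : RHS n m ≤ LHS n m
  RHS≤LHS = *-cancelˡ-≤ (4 ^ m * 4 ^ n) (+-cancelʳ-≤ cross _ _ (begin
    4 ^ m * 4 ^ n * RHS n m + cross   ≡⟨ cong (_+ cross) 2ab≡4^m*4^n*RHS ⟨
    2 * (a * b) + cross               ≤⟨ +-mono-≤ (2mn≤m²+n² a b) cross≤squares ⟩
    a * a + b * b + squares           ≡⟨ +-comm (a * a + b * b) squares ⟩
    squares + (a * a + b * b)         ≡⟨ LHS-balance ⟨
    4 ^ m * 4 ^ n * LHS n m + cross   ∎))
    where open ≤-Reasoning

  LHS≡RHS⇒m≡n : LHS n m ≡ RHS n m → m ≡ n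
  LHS≡RHS⇒m≡n eq = 4^m*central[n]≡4^n*central[m]⇒m≡n n m (2mn≡m²+n²⇒m≡n a b
    (m+n≡o+p⇒o≤m⇒p≤n⇒n≡p (begin
      squares + (a * a + b * b)         ≡⟨ LHS-balance ⟨
      4 ^ m * 4 ^ n * LHS n m + cross   ≡⟨ cong (λ L → 4 ^ m * 4 ^ n * L + cross) eq ⟩
      4 ^ m * 4 ^ n * RHS n m + cross   ≡⟨ cong (_+ cross) 2ab≡4^m*4^n*RHS ⟨
      2 * (a * b) + cross               ≡⟨ +-comm (2 * (a * b)) cross ⟩
      cross + 2 * (a * b)               ∎) cross≤squares (2mn≤m²+n² a b)))
    where open ≡-Reasoning

theorem7p1 : (m n : ℕ) → RHS n m ≤ LHS n m × (LHS n m ≡ RHS n m ⇔ m ≡ n)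
theorem7p1 m n = RHS≤LHS n m , mk⇔ (LHS≡RHS⇒m≡n n m) λ { refl → LHS-diagonal n }
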